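{- Let $H$ be a subgraph of the complete graph $\mathcal K_n$ on $[n]$, let $M\ge1$, and let $L_1,\dots,L_k$ be self-avoiding paths in $\mathcal K_n$ with $\operatorname{EndP}(L_i)\subset V(H)$ and $|E(L_i)|\le M$ for all $i$. Let $S=H\cup L_1\cup\dots\cup L_k$. Then $E(S)\setminus E(H)$ can be decomposed (partitioned) into the edge sets of $\mathtt t\ge0$ self-avoiding paths $P_1,\dots,P_{\mathtt t}$ such that: (1) $V(P_j)\cap\big(V(H)\cup\bigcup_{k=1}^{j-1}V(P_k)\cup\mathcal L(S)\big)=\operatorname{EndP}(P_j)$ for $1\le j\le\mathtt t$; (2) $|E(P_i)|\le M$ for all $i$; (3) $\mathtt t=\tau(S)-\tau(H)$.
   Context: Graphs are simple subgraphs of $\mathcal K_n$; for graphs $H,S$, $H\cup S$ has vertex set $V(H)\cup V(S)$ and edge set $E(H)\cup E(S)$. A self-avoiding path is a path $(w_0,w_1,\dots,w_{m+1})$ with all vertices distinct; $\operatorname{EndP}(P)=\{w_0,w_{m+1}\}$ is its set of endpoints. $\mathcal L(S)$ is the set of leaves (degree-1 vertices) of $S$. The excess of a graph is $\tau(H)=|E(H)|-|V(H)|$. -}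

module Defs where

open import Data.Nat using (ℕ; zero; suc; _≡ᵇ_)
open import Data.Bool using (Bool; true; false; if_then_else_)
open import Data.Fin using (Fin; _<_)
open import Data.Fin.Properties using (_≟_; _<?_)
open import Data.Fin.Subset using (Subset; ⁅_⁆; _∪_; _∩_; ⊥; ∣_∣; _∈_; _∉_; _⊆_)
open import Data.Vec using (tabulate)
open import Data.List using (List; []; _∷_; map; foldr; allFin; length)
open import Data.List.Relation.Unary.Unique.Propositional using (Unique)
open import Data.Product using (_×_; _,_)
open import Data.Sum using (_⊎_)
open import Data.Nat.ListAction using (sum)
open import Data.Integer using (ℤ; +_; _-_)
open import Relation.Nullary using (does)
open import Relation.Binary.PropositionalEquality using (_≡_)

-- A graph on the vertex set [n] = Fin n, given by its vertex set V and
-- its adjacency rows: j ∈ adj i  means that {i,j} is an edge.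
record Graph (n : ℕ) : Set where
  constructor mkGraph
  field
    V   : Subset n
    adj : Fin n → Subset n
open Graph public

IsGraph : ∀ {n} → Graph n → Set
IsGraph G = (∀ i j → j ∈ adj G i → i ∈ adj G j)
          × (∀ i → i ∉ adj G i)
          × (∀ i j → j ∈ adj G i → i ∈ V G)

_∪ᴳ_ : ∀ {n} → Graph n → Graph n → Graph n
G ∪ᴳ K = mkGraph (V G ∪ V K) (λ i → adj G i ∪ adj K i)

-- number of edges |E(G)|: pairs i < j with {i,j} an edge
edgeCount : ∀ {n} → Graph n → ℕ
edgeCount {n} G = sum (map (λ i → ∣ adj G i ∩ tabulate (λ j → does (i <? j)) ∣) (allFin n))

τ : ∀ {n} → Graph n → ℤ
τ G = + edgeCount G - + ∣ V G ∣

leaves : ∀ {n} → Graph n → Subset n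
leaves G = tabulate (λ i → ∣ adj G i ∣ ≡ᵇ 1)

-- Paths are vertex sequences (w_0, …, w_{m+1}).
-- Self-avoiding path: all vertices distinct, at least one edge (m ≥ 0).
IsSAPath : ∀ {n} → List (Fin n) → Set
IsSAPath P = Unique P × (2 Data.Nat.≤ length P)

vset : ∀ {n} → List (Fin n) → Subset n
vset = foldr (λ w s → ⁅ w ⁆ ∪ s) ⊥

steps : ∀ {A : Set} → List A → List (A × A)
steps (x ∷ y ∷ r) = (x , y) ∷ steps (y ∷ r)
steps _ = []

pathAdj : ∀ {n} → List (Fin n) → Fin n → Subset n
pathAdj P i = foldr (λ { (a , b) s →
                 (if does (a ≟ i) then ⁅ b ⁆ else ⊥) ∪
                 ((if does (b ≟ i) then ⁅ a ⁆ else ⊥) ∪ s) }) ⊥ (steps P)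

pathGraph : ∀ {n} → List (Fin n) → Graph n
pathGraph P = mkGraph (vset P) (pathAdj P)

lastOr : ∀ {A : Set} → A → List A → A
lastOr d [] = d
lastOr d (x ∷ xs) = lastOr x xs

endP : ∀ {n} → List (Fin n) → Subset n
endP [] = ⊥
endP (x ∷ xs) = ⁅ x ⁆ ∪ ⁅ lastOr x xs ⁆

unionPaths : ∀ {n} → Graph n → List (List (Fin n)) → Graph n
unionPaths H Ls = foldr (λ L G → G ∪ᴳ pathGraph L) H Ls

vsets : ∀ {n} → List (List (Fin n)) → Subset n
vsets = foldr (λ P s → vset P ∪ s) ⊥

-- The paths L₁, …, L_k are added to H one at a time, keeping a decomposition of the new edges
-- into pieces.  A path L is cut at every vertex already in the current graph G; the interior
-- vertices of a segment between consecutive cuts lie outside G, so unless the segment is a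
-- single edge of G it becomes a new piece meeting G exactly in its endpoints.  A piece adds one
-- more edge than vertices, hence raises the excess τ by one, and it has at most |E(L)| ≤ M
-- edges.  An interior vertex of a piece has two neighbours on it, so it is not a leaf of S.
module Submission where

open import Defs
open import Data.Nat using (ℕ; zero; suc; _+_; _∸_; _≤_; s≤s)
open import Data.Bool using (T; if_then_else_)
open import Data.Nat.Properties
  using (+-suc; +-comm; +-assoc; +-identityʳ; ≤-trans; n≤1+n; <⇒≢; ≡ᵇ⇒≡; m≤n+m; +-commutativeSemigroup)
open import Data.Nat.Tactic.RingSolver using (solve-∀)
open import Algebra.Properties.CommutativeSemigroup +-commutativeSemigroup using (interchange)
open import Data.Unit using (⊤; tt)
open import Function using (_∘_; id)
open import Data.Fin using (Fin; zero; suc; toℕ) renaming (_<_ to _<ᶠ_)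
open import Data.Fin.Properties using (_≟_; _<?_; <-cmp; suc-injective)
open import Data.Fin.Subset
  using (Subset; inside; outside; ⁅_⁆; _∪_; _∩_; ⊥; ∣_∣; _∈_; _∉_; _⊆_)
open import Data.Fin.Subset.Properties
  using (⊆-antisym; _∈?_; x∈p∪q⁻; x∈p∪q⁺; x∈p∩q⁺; x∈p∩q⁻; x∈⁅x⁆; x∈⁅y⁆⇒x≡y; ∉⊥;
         p⊆q⇒∣p∣≤∣q∣; ∣⁅x⁆∣≡1; ∣⊥∣≡0; Empty-unique; ∩-zeroˡ; ∩-distribʳ-∪;
         ∪-assoc; ∪-identityˡ; ∪-identityʳ; ∩-distribˡ-∪; p⊆p∪q)
open import Data.Vec using ([]; _∷_; here; there)
import Data.Vec as Vec
open import Data.Vec.Properties using (lookup⇒[]=; []=⇒lookup; lookup∘tabulate)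
open import Data.List using (List; []; _∷_; _++_; map; allFin; tabulate; length; lookup; take)
open import Data.List.Relation.Unary.Any using (Any; here; there)
import Data.List.Relation.Unary.Any.Properties as Any
open import Data.List.Relation.Unary.All using (All; []; _∷_)
import Data.List.Relation.Unary.All as All
open import Data.List.Relation.Unary.All.Properties using (All¬⇒¬Any)
import Data.List.Relation.Unary.All.Properties as AllP
open import Data.List.Relation.Unary.AllPairs using (AllPairs; []; _∷_)
import Data.List.Relation.Unary.AllPairs.Properties as AllPairs
open import Data.List.Relation.Unary.Unique.Propositional using (Unique)
open import Data.List.Membership.Propositional using () renaming (_∈_ to _∈ₗ_)
open import Data.List.Membership.Propositional.Properties using (∈-lookup)
open import Data.List.Properties
  using (map-tabulate; map-cong; length-++; length-++-≤ˡ; length-++-≤ʳ; ++-assoc; ++-identityʳ)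
open import Data.Nat.ListAction using (sum)
open import Data.Product using (_×_; _,_; proj₁; proj₂; ∃; Σ-syntax)
open import Data.Sum using (_⊎_; inj₁; inj₂; [_,_]′)
open import Relation.Nullary using (¬_; yes; no; does; contradiction)
open import Relation.Nullary.Decidable using (dec-true; dec-false)
open import Relation.Binary using (tri<; tri≈; tri>)
open import Relation.Binary.PropositionalEquality
  using (_≡_; _≢_; refl; sym; trans; cong; cong₂; subst; subst₂; module ≡-Reasoning)

∣p∪q∣≡∣p∣+∣q∣ : ∀ {n} (p q : Subset n) → (∀ {x} → x ∈ p → x ∉ q) →
                ∣ p ∪ q ∣ ≡ ∣ p ∣ + ∣ q ∣
∣p∪q∣≡∣p∣+∣q∣ []            []            _ = refl
∣p∪q∣≡∣p∣+∣q∣ (inside  ∷ p) (inside  ∷ q) d = contradiction here (d here)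
∣p∪q∣≡∣p∣+∣q∣ (inside  ∷ p) (outside ∷ q) d =
  cong suc (∣p∪q∣≡∣p∣+∣q∣ p q (λ x∈p → d (there x∈p) ∘ there))
∣p∪q∣≡∣p∣+∣q∣ (outside ∷ p) (inside  ∷ q) d =
  trans (cong suc (∣p∪q∣≡∣p∣+∣q∣ p q (λ x∈p → d (there x∈p) ∘ there))) (sym (+-suc ∣ p ∣ ∣ q ∣))
∣p∪q∣≡∣p∣+∣q∣ (outside ∷ p) (outside ∷ q) d =
  ∣p∪q∣≡∣p∣+∣q∣ p q (λ x∈p → d (there x∈p) ∘ there)

∣p∪⁅x⁆∣≡1+∣p∣ : ∀ {n} (p : Subset n) {x} → x ∉ p → ∣ p ∪ ⁅ x ⁆ ∣ ≡ suc ∣ p ∣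
∣p∪⁅x⁆∣≡1+∣p∣ p {x} x∉p = begin
  ∣ p ∪ ⁅ x ⁆ ∣      ≡⟨ ∣p∪q∣≡∣p∣+∣q∣ p ⁅ x ⁆ disjoint ⟩
  ∣ p ∣ + ∣ ⁅ x ⁆ ∣  ≡⟨ cong (∣ p ∣ +_) (∣⁅x⁆∣≡1 x) ⟩
  ∣ p ∣ + 1          ≡⟨ +-comm ∣ p ∣ 1 ⟩
  suc ∣ p ∣          ∎
  where
  open ≡-Reasoning
  disjoint : ∀ {y} → y ∈ p → y ∉ ⁅ x ⁆
  disjoint y∈p y∈⁅x⁆ = x∉p (subst (_∈ p) (x∈⁅y⁆⇒x≡y x y∈⁅x⁆) y∈p)

x≢y⇒2≤∣p∣ : ∀ {n} {p : Subset n} {x y} → x ≢ y → x ∈ p → y ∈ p → 2 ≤ ∣ p ∣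
x≢y⇒2≤∣p∣ {p = p} {x} {y} x≢y x∈p y∈p =
  subst (_≤ ∣ p ∣) (trans (∣p∪⁅x⁆∣≡1+∣p∣ ⁅ x ⁆ y∉⁅x⁆) (cong suc (∣⁅x⁆∣≡1 x)))
        (p⊆q⇒∣p∣≤∣q∣ ⁅x,y⁆⊆p)
  where
  y∉⁅x⁆ : y ∉ ⁅ x ⁆
  y∉⁅x⁆ y∈⁅x⁆ = x≢y (sym (x∈⁅y⁆⇒x≡y x y∈⁅x⁆))
  ⁅x,y⁆⊆p : ⁅ x ⁆ ∪ ⁅ y ⁆ ⊆ p
  ⁅x,y⁆⊆p z∈ with x∈p∪q⁻ ⁅ x ⁆ ⁅ y ⁆ z∈
  ... | inj₁ z∈⁅x⁆ = subst (_∈ p) (sym (x∈⁅y⁆⇒x≡y x z∈⁅x⁆)) x∈p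
  ... | inj₂ z∈⁅y⁆ = subst (_∈ p) (sym (x∈⁅y⁆⇒x≡y y z∈⁅y⁆)) y∈p

∣⊥∩p∣≡0 : ∀ {n} (p : Subset n) → ∣ ⊥ ∩ p ∣ ≡ 0
∣⊥∩p∣≡0 {n} p = trans (cong ∣_∣ (∩-zeroˡ p)) (∣⊥∣≡0 n)

∣⁅x⁆∩p∣≡1 : ∀ {n} {x : Fin n} {p} → x ∈ p → ∣ ⁅ x ⁆ ∩ p ∣ ≡ 1
∣⁅x⁆∩p∣≡1 {x = x} {p} x∈p =
  trans (cong ∣_∣ (⊆-antisym (proj₁ ∘ x∈p∩q⁻ ⁅ x ⁆ p) ⁅x⁆⊆⁅x⁆∩p)) (∣⁅x⁆∣≡1 x)
  where
  ⁅x⁆⊆⁅x⁆∩p : ⁅ x ⁆ ⊆ ⁅ x ⁆ ∩ p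
  ⁅x⁆⊆⁅x⁆∩p z∈⁅x⁆ = x∈p∩q⁺ (z∈⁅x⁆ , subst (_∈ p) (sym (x∈⁅y⁆⇒x≡y x z∈⁅x⁆)) x∈p)

∣⁅x⁆∩p∣≡0 : ∀ {n} {x : Fin n} {p} → x ∉ p → ∣ ⁅ x ⁆ ∩ p ∣ ≡ 0
∣⁅x⁆∩p∣≡0 {n} {x} {p} x∉p = trans (cong ∣_∣ (Empty-unique empty)) (∣⊥∣≡0 n)
  where
  empty : ¬ (∃ λ z → z ∈ ⁅ x ⁆ ∩ p)
  empty (z , z∈) with x∈p∩q⁻ ⁅ x ⁆ p z∈
  ... | z∈⁅x⁆ , z∈p = x∉p (subst (_∈ p) (x∈⁅y⁆⇒x≡y x z∈⁅x⁆) z∈p)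

q⊆p⇒p∪q≡p : ∀ {n} {p q : Subset n} → q ⊆ p → p ∪ q ≡ p
q⊆p⇒p∪q≡p {p = p} {q} q⊆p = ⊆-antisym ([ id , q⊆p ]′ ∘ x∈p∪q⁻ p q) (p⊆p∪q q)

sum-map-+ : ∀ {A : Set} (f g : A → ℕ) xs → sum (map (λ x → f x + g x) xs) ≡ sum (map f xs) + sum (map g xs)
sum-map-+ f g []       = refl
sum-map-+ f g (x ∷ xs) = trans (cong (f x + g x +_) (sum-map-+ f g xs)) (interchange (f x) (g x) _ _)

sum-tabulate-0 : ∀ {n} (f : Fin n → ℕ) → (∀ i → f i ≡ 0) → sum (tabulate f) ≡ 0
sum-tabulate-0 {zero}  f f≡0 = refl
sum-tabulate-0 {suc n} f f≡0 = cong₂ _+_ (f≡0 zero) (sum-tabulate-0 (λ i → f (suc i)) (λ i → f≡0 (suc i)))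

sum-tabulate-single : ∀ {n} (f : Fin n → ℕ) k → (∀ i → i ≢ k → f i ≡ 0) → sum (tabulate f) ≡ f k
sum-tabulate-single {suc n} f zero f≡0 =
  trans (cong (f zero +_) (sum-tabulate-0 (λ i → f (suc i)) (λ i → f≡0 (suc i) (λ ()))))
        (+-identityʳ (f zero))
sum-tabulate-single {suc n} f (suc k) f≡0 =
  cong₂ _+_ (f≡0 zero (λ ()))
            (sum-tabulate-single (λ i → f (suc i)) k (λ i i≢k → f≡0 (suc i) (i≢k ∘ suc-injective)))

steps-++ : ∀ {A : Set} (xs : List A) x r → steps (xs ++ x ∷ r) ≡ steps (xs ++ x ∷ []) ++ steps (x ∷ r)
steps-++ []           x r = refl
steps-++ (y ∷ [])     x r = refl
steps-++ (y ∷ z ∷ xs) x r = cong ((y , z) ∷_) (steps-++ (z ∷ xs) x r)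

lastOr-∈ : ∀ {A : Set} (d : A) xs → lastOr d xs ∈ₗ d ∷ xs
lastOr-∈ d []       = here refl
lastOr-∈ d (x ∷ xs) = there (lastOr-∈ x xs)

lastOr-++ : ∀ {A : Set} (d : A) xs y ys → lastOr d (xs ++ y ∷ ys) ≡ lastOr y ys
lastOr-++ d []       y ys = refl
lastOr-++ d (x ∷ xs) y ys = lastOr-++ x xs y ys

AllPairs-++⁻ˡ : ∀ {A : Set} {R : A → A → Set} xs {ys} → AllPairs R (xs ++ ys) → AllPairs R xs
AllPairs-++⁻ˡ []       _          = []
AllPairs-++⁻ˡ (x ∷ xs) (px ∷ pxs) = AllP.++⁻ˡ xs px ∷ AllPairs-++⁻ˡ xs pxs

AllPairs-++⁻ʳ : ∀ {A : Set} {R : A → A → Set} xs {ys} → AllPairs R (xs ++ ys) → AllPairs R ys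
AllPairs-++⁻ʳ []       pxs        = pxs
AllPairs-++⁻ʳ (x ∷ xs) (_  ∷ pxs) = AllPairs-++⁻ʳ xs pxs

AllPairs-init : ∀ {A : Set} {R : A → A → Set} xs {y r} → AllPairs R (xs ++ y ∷ r) → AllPairs R (xs ++ y ∷ [])
AllPairs-init xs {y} {r} = AllPairs-++⁻ˡ (xs ++ y ∷ []) ∘ subst (AllPairs _) (sym (++-assoc xs (y ∷ []) r))

length-init≤ : ∀ {A : Set} (xs : List A) {y r} → length (xs ++ y ∷ []) ≤ length (xs ++ y ∷ r)
length-init≤ xs {y} {r} =
  subst (λ zs → length (xs ++ y ∷ []) ≤ length zs) (++-assoc xs (y ∷ []) r) (length-++-≤ˡ (xs ++ y ∷ []))

length-tail≤ : ∀ {A : Set} (xs : List A) {y r} → length r ≤ length (xs ++ y ∷ r)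
length-tail≤ xs {y} {r} = ≤-trans (n≤1+n (length r)) (length-++-≤ʳ (y ∷ r) {xs})

-- Counting edges
-- edgeCount G is edges (adj G) by definition: an edge {i, j} with i < j is counted at i.
above : ∀ {n} → Fin n → Subset n
above i = Vec.tabulate (λ j → does (i <? j))

i<j⇒j∈above : ∀ {n} {i j : Fin n} → i <ᶠ j → j ∈ above i
i<j⇒j∈above {i = i} {j} i<j = lookup⇒[]= j (above i) (trans (lookup∘tabulate _ j) (dec-true (i <? j) i<j))

i≮j⇒j∉above : ∀ {n} {i j : Fin n} → ¬ i <ᶠ j → j ∉ above i
i≮j⇒j∉above {i = i} {j} i≮j j∈
  with trans (sym ([]=⇒lookup j∈)) (trans (lookup∘tabulate _ j) (dec-false (i <? j) i≮j))
... | ()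

edges : ∀ {n} → (Fin n → Subset n) → ℕ
edges {n} a = sum (map (λ i → ∣ a i ∩ above i ∣) (allFin n))

edges-tabulate : ∀ {n} (a : Fin n → Subset n) → edges a ≡ sum (tabulate (λ i → ∣ a i ∩ above i ∣))
edges-tabulate {n} a = cong sum (map-tabulate {n = n} id (λ i → ∣ a i ∩ above i ∣))

edges-cong : ∀ {n} {a b : Fin n → Subset n} → (∀ i → a i ≡ b i) → edges a ≡ edges b
edges-cong {n} a≡b = cong sum (map-cong (λ i → cong (λ s → ∣ s ∩ above i ∣) (a≡b i)) (allFin n))

edges-∪ : ∀ {n} (a b : Fin n → Subset n) → (∀ i {j} → j ∈ a i → j ∉ b i) →
          edges (λ i → a i ∪ b i) ≡ edges a + edges b
edges-∪ {n} a b disjoint = trans (cong sum (map-cong split (allFin n))) (sum-map-+ _ _ (allFin n))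
  where
  split : ∀ i → ∣ (a i ∪ b i) ∩ above i ∣ ≡ ∣ a i ∩ above i ∣ + ∣ b i ∩ above i ∣
  split i = trans (cong ∣_∣ (∩-distribʳ-∪ (above i) (a i) (b i)))
                  (∣p∪q∣≡∣p∣+∣q∣ _ _ λ j∈a∩ j∈b∩ →
                     disjoint i (proj₁ (x∈p∩q⁻ _ _ j∈a∩)) (proj₁ (x∈p∩q⁻ _ _ j∈b∩)))

edges-⊥ : ∀ {n} → edges {n} (λ _ → ⊥) ≡ 0
edges-⊥ {n} = trans (edges-tabulate {n} (λ _ → ⊥)) (sum-tabulate-0 {n} _ (∣⊥∩p∣≡0 ∘ above))

arc : ∀ {n} → Fin n → Fin n → Fin n → Subset n
arc x y i = if does (x ≟ i) then ⁅ y ⁆ else ⊥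

edges-arc : ∀ {n} (x y : Fin n) → edges (arc x y) ≡ ∣ ⁅ y ⁆ ∩ above x ∣
edges-arc {n} x y = trans (edges-tabulate (arc x y)) (trans (sum-tabulate-single _ x off-x) at-x)
  where
  off-x : ∀ i → i ≢ x → ∣ arc x y i ∩ above i ∣ ≡ 0
  off-x i i≢x with x ≟ i
  ... | yes x≡i = contradiction (sym x≡i) i≢x
  ... | no  _   = ∣⊥∩p∣≡0 (above i)
  at-x : ∣ arc x y x ∩ above x ∣ ≡ ∣ ⁅ y ⁆ ∩ above x ∣
  at-x with x ≟ x
  ... | yes _   = refl
  ... | no  x≢x = contradiction refl x≢x

edges-arc+arc≡1 : ∀ {n} {x y : Fin n} → x ≢ y → edges (arc x y) + edges (arc y x) ≡ 1
edges-arc+arc≡1 {x = x} {y} x≢y rewrite edges-arc x y | edges-arc y x with <-cmp x y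
... | tri< x<y _ y≮x = cong₂ _+_ (∣⁅x⁆∩p∣≡1 (i<j⇒j∈above x<y))
                                (∣⁅x⁆∩p∣≡0 (i≮j⇒j∉above y≮x))
... | tri≈ _ x≡y _   = contradiction x≡y x≢y
... | tri> x≮y _ y<x = cong₂ _+_ (∣⁅x⁆∩p∣≡0 (i≮j⇒j∉above x≮y))
                                (∣⁅x⁆∩p∣≡1 (i<j⇒j∈above y<x))

-- Paths as vertex lists
Joins : ∀ {A : Set} → A × A → A → A → Set
Joins (a , b) i j = (a ≡ i × b ≡ j) ⊎ (b ≡ i × a ≡ j)

PathEdge : ∀ {A : Set} → List A → A → A → Set
PathEdge P i j = Any (λ s → Joins s i j) (steps P)

∈-arc⁻ : ∀ {n} (a b : Fin n) {i j} → j ∈ arc a b i → a ≡ i × b ≡ j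
∈-arc⁻ a b {i} j∈ with a ≟ i
... | yes a≡i = a≡i , sym (x∈⁅y⁆⇒x≡y b j∈)
... | no  _   = contradiction j∈ ∉⊥

∈-arc⁺ : ∀ {n} (a b : Fin n) → b ∈ arc a b a
∈-arc⁺ a b with a ≟ a
... | yes _   = x∈⁅x⁆ b
... | no  a≢a = contradiction refl a≢a

∈-pathAdj⁻ : ∀ {n} (P : List (Fin n)) {i j} → j ∈ pathAdj P i → PathEdge P i j
∈-pathAdj⁻ []          j∈ = contradiction j∈ ∉⊥
∈-pathAdj⁻ (x ∷ [])    j∈ = contradiction j∈ ∉⊥
∈-pathAdj⁻ (x ∷ y ∷ r) j∈ =
  [ (λ j∈xy → here (inj₁ (∈-arc⁻ x y j∈xy)))
  , (λ j∈′ → [ (λ j∈yx → here (inj₂ (∈-arc⁻ y x j∈yx)))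
             , (λ j∈r → there (∈-pathAdj⁻ (y ∷ r) j∈r)) ]′ (x∈p∪q⁻ (arc y x _) _ j∈′))
  ]′ (x∈p∪q⁻ (arc x y _) _ j∈)

∈-pathAdj⁺ : ∀ {n} (P : List (Fin n)) {i j} → PathEdge P i j → j ∈ pathAdj P i
∈-pathAdj⁺ (x ∷ y ∷ r) (here (inj₁ (refl , refl))) = x∈p∪q⁺ (inj₁ (∈-arc⁺ x y))
∈-pathAdj⁺ (x ∷ y ∷ r) (here (inj₂ (refl , refl))) = x∈p∪q⁺ (inj₂ (x∈p∪q⁺ (inj₁ (∈-arc⁺ y x))))
∈-pathAdj⁺ (x ∷ y ∷ r) (there e)                   =
  x∈p∪q⁺ (inj₂ (x∈p∪q⁺ (inj₂ (∈-pathAdj⁺ (y ∷ r) e))))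

∈-vset⁻ : ∀ {n} (xs : List (Fin n)) {x} → x ∈ vset xs → x ∈ₗ xs
∈-vset⁻ []       x∈ = contradiction x∈ ∉⊥
∈-vset⁻ (y ∷ xs) x∈ with x∈p∪q⁻ _ _ x∈
... | inj₁ x∈⁅y⁆ = here (x∈⁅y⁆⇒x≡y y x∈⁅y⁆)
... | inj₂ x∈xs  = there (∈-vset⁻ xs x∈xs)

∈-vset⁺ : ∀ {n} (xs : List (Fin n)) {x} → x ∈ₗ xs → x ∈ vset xs
∈-vset⁺ (y ∷ xs) (here refl) = x∈p∪q⁺ (inj₁ (x∈⁅x⁆ y))
∈-vset⁺ (y ∷ xs) (there x∈)  = x∈p∪q⁺ (inj₂ (∈-vset⁺ xs x∈))

PathEdge-sym : ∀ {A : Set} (P : List A) {i j} → PathEdge P i j → PathEdge P j i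
PathEdge-sym (x ∷ y ∷ r) (here (inj₁ (a≡i , b≡j))) = here (inj₂ (b≡j , a≡i))
PathEdge-sym (x ∷ y ∷ r) (here (inj₂ (b≡i , a≡j))) = here (inj₁ (a≡j , b≡i))
PathEdge-sym (x ∷ y ∷ r) (there e)                 = there (PathEdge-sym (y ∷ r) e)

PathEdge⇒∈ : ∀ {A : Set} (P : List A) {i j} → PathEdge P i j → i ∈ₗ P × j ∈ₗ P
PathEdge⇒∈ (x ∷ y ∷ r) (here (inj₁ (refl , refl))) = here refl , there (here refl)
PathEdge⇒∈ (x ∷ y ∷ r) (here (inj₂ (refl , refl))) = there (here refl) , here refl
PathEdge⇒∈ (x ∷ y ∷ r) (there e) with PathEdge⇒∈ (y ∷ r) e
... | i∈ , j∈ = there i∈ , there j∈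

PathEdge-touches-interior : ∀ {A : Set} (u a : A) as y {i j} →
                            PathEdge (u ∷ a ∷ as ++ y ∷ []) i j → i ∈ₗ a ∷ as ⊎ j ∈ₗ a ∷ as
PathEdge-touches-interior u a as       y (here (inj₁ (_ , a≡j)))         = inj₂ (here (sym a≡j))
PathEdge-touches-interior u a as       y (here (inj₂ (a≡i , _)))         = inj₁ (here (sym a≡i))
PathEdge-touches-interior u a []       y (there (here (inj₁ (a≡i , _)))) = inj₁ (here (sym a≡i))
PathEdge-touches-interior u a []       y (there (here (inj₂ (_ , a≡j)))) = inj₂ (here (sym a≡j))
PathEdge-touches-interior u a (b ∷ as) y (there e) with PathEdge-touches-interior a b as y e
... | inj₁ i∈ = inj₁ (there i∈)
... | inj₂ j∈ = inj₂ (there j∈)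

module _ {A : Set} (xs : List A) (x : A) (r : List A) where

  PathEdge-++⁻ : ∀ {i j} → PathEdge (xs ++ x ∷ r) i j →
                 PathEdge (xs ++ x ∷ []) i j ⊎ PathEdge (x ∷ r) i j
  PathEdge-++⁻ e = Any.++⁻ (steps (xs ++ x ∷ [])) (subst (Any _) (steps-++ xs x r) e)

  PathEdge-++⁺ : ∀ {i j} → PathEdge (xs ++ x ∷ []) i j ⊎ PathEdge (x ∷ r) i j →
                 PathEdge (xs ++ x ∷ r) i j
  PathEdge-++⁺ e =
    subst (Any _) (sym (steps-++ xs x r)) ([ Any.++⁺ˡ , Any.++⁺ʳ (steps (xs ++ x ∷ [])) ]′ e)

  ∈-++-shared⁻ : ∀ {y} → y ∈ₗ xs ++ x ∷ r → y ∈ₗ xs ++ x ∷ [] ⊎ y ∈ₗ x ∷ r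
  ∈-++-shared⁻ y∈ = [ inj₁ ∘ Any.++⁺ˡ , inj₂ ]′ (Any.++⁻ xs y∈)

  ∈-++-shared⁺ : ∀ {y} → y ∈ₗ xs ++ x ∷ [] ⊎ y ∈ₗ x ∷ r → y ∈ₗ xs ++ x ∷ r
  ∈-++-shared⁺ (inj₁ y∈) with Any.++⁻ xs y∈
  ... | inj₁ y∈xs       = Any.++⁺ˡ y∈xs
  ... | inj₂ (here y≡x) = Any.++⁺ʳ xs (here y≡x)
  ∈-++-shared⁺ (inj₂ y∈) = Any.++⁺ʳ xs y∈

interior-neighbours : ∀ {n} (p : Fin n) ps {x} → Unique (p ∷ ps) →
                      x ∈ₗ p ∷ ps → x ≢ p → x ≢ lastOr p ps →
                      Σ[ a ∈ Fin n ] Σ[ b ∈ Fin n ] a ≢ b × PathEdge (p ∷ ps) x a × PathEdge (p ∷ ps) x b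
interior-neighbours p ps           _ (here x≡p) x≢p _ = contradiction x≡p x≢p
interior-neighbours p (q ∷ qs) {x} (p∉ ∷ uq) (there x∈) x≢p x≢last with x ≟ q
interior-neighbours p (q ∷ [])     (p∉ ∷ uq) (there x∈) x≢p x≢last | yes x≡q = contradiction x≡q x≢last
interior-neighbours p (q ∷ s ∷ qs) (p∉ ∷ uq) (there x∈) x≢p x≢last | yes refl =
  p , s , (λ p≡s → All¬⇒¬Any p∉ (there (here p≡s))) ,
  here (inj₂ (refl , refl)) , there (here (inj₁ (refl , refl)))
... | no x≢q with interior-neighbours q qs uq x∈ x≢q x≢last
... | a , b , a≢b , xa , xb = a , b , a≢b , there xa , there xb

edges-pathAdj : ∀ {n} (P : List (Fin n)) → Unique P → edges (pathAdj P) ≡ length P ∸ 1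
edges-pathAdj {n} []          _ = edges-⊥ {n}
edges-pathAdj {n} (x ∷ [])    _ = edges-⊥ {n}
edges-pathAdj (x ∷ y ∷ r) (x∉ ∷ uq) = begin
  edges (λ i → arc x y i ∪ (arc y x i ∪ pathAdj (y ∷ r) i))
    ≡⟨ edges-∪ (arc x y) _ arc-xy-new ⟩
  edges (arc x y) + edges (λ i → arc y x i ∪ pathAdj (y ∷ r) i)
    ≡⟨ cong (edges (arc x y) +_) (edges-∪ (arc y x) _ arc-yx-new) ⟩
  edges (arc x y) + (edges (arc y x) + edges (pathAdj (y ∷ r)))
    ≡⟨ sym (+-assoc (edges (arc x y)) _ _) ⟩
  edges (arc x y) + edges (arc y x) + edges (pathAdj (y ∷ r))
    ≡⟨ cong₂ _+_ (edges-arc+arc≡1 x≢y) (edges-pathAdj (y ∷ r) uq) ⟩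
  suc (length r) ∎
  where
  open ≡-Reasoning
  x∉yr : ¬ x ∈ₗ y ∷ r
  x∉yr = All¬⇒¬Any x∉
  x≢y : x ≢ y
  x≢y x≡y = x∉yr (here x≡y)
  arc-yx-new : ∀ i {j} → j ∈ arc y x i → j ∉ pathAdj (y ∷ r) i
  arc-yx-new i j∈ j∈r with ∈-arc⁻ y x j∈
  ... | _ , refl = x∉yr (proj₂ (PathEdge⇒∈ (y ∷ r) (∈-pathAdj⁻ (y ∷ r) j∈r)))
  arc-xy-new : ∀ i {j} → j ∈ arc x y i → j ∉ arc y x i ∪ pathAdj (y ∷ r) i
  arc-xy-new i j∈ j∈′ with ∈-arc⁻ x y j∈ | x∈p∪q⁻ (arc y x i) _ j∈′
  ... | refl , _ | inj₁ j∈yx = x≢y (sym (proj₁ (∈-arc⁻ y x j∈yx)))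
  ... | refl , _ | inj₂ j∈r  = x∉yr (proj₁ (PathEdge⇒∈ (y ∷ r) (∈-pathAdj⁻ (y ∷ r) j∈r)))

vsets-++ : ∀ {n} (Ps Qs : List (List (Fin n))) → vsets (Ps ++ Qs) ≡ vsets Ps ∪ vsets Qs
vsets-++ {n} []       Qs = sym (∪-identityˡ (vsets Qs))
vsets-++     (P ∷ Ps) Qs =
  trans (cong (vset P ∪_) (vsets-++ Ps Qs)) (sym (∪-assoc (vset P) (vsets Ps) (vsets Qs)))

∣p∪vset∣≡∣p∣+length : ∀ {n} (p : Subset n) xs → All (_∉ p) xs → Unique xs →
                      ∣ p ∪ vset xs ∣ ≡ ∣ p ∣ + length xs
∣p∪vset∣≡∣p∣+length p []       _            _         =
  trans (cong ∣_∣ (∪-identityʳ p)) (sym (+-identityʳ ∣ p ∣))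
∣p∪vset∣≡∣p∣+length p (x ∷ xs) (x∉p ∷ xs∉p) (x∉ ∷ uq) = begin
  ∣ p ∪ (⁅ x ⁆ ∪ vset xs) ∣  ≡⟨ cong ∣_∣ (sym (∪-assoc p ⁅ x ⁆ (vset xs))) ⟩
  ∣ (p ∪ ⁅ x ⁆) ∪ vset xs ∣  ≡⟨ ∣p∪vset∣≡∣p∣+length (p ∪ ⁅ x ⁆) xs (fresh xs xs∉p x∉) uq ⟩
  ∣ p ∪ ⁅ x ⁆ ∣ + length xs  ≡⟨ cong (_+ length xs) (∣p∪⁅x⁆∣≡1+∣p∣ p x∉p) ⟩
  suc ∣ p ∣ + length xs      ≡⟨ sym (+-suc ∣ p ∣ (length xs)) ⟩
  ∣ p ∣ + suc (length xs)    ∎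
  where
  open ≡-Reasoning
  fresh : ∀ ys → All (_∉ p) ys → All (x ≢_) ys → All (_∉ p ∪ ⁅ x ⁆) ys
  fresh []       _            _            = []
  fresh (y ∷ ys) (y∉p ∷ ys∉p) (x≢y ∷ x≢ys) = y∉p∪⁅x⁆ ∷ fresh ys ys∉p x≢ys
    where
    y∉p∪⁅x⁆ : y ∉ p ∪ ⁅ x ⁆
    y∉p∪⁅x⁆ = [ y∉p , (λ y∈⁅x⁆ → x≢y (sym (x∈⁅y⁆⇒x≡y x y∈⁅x⁆))) ]′ ∘ x∈p∪q⁻ p ⁅ x ⁆

∈-endP⁻ : ∀ {n} (u : Fin n) xs {x} → x ∈ endP (u ∷ xs) → x ≡ u ⊎ x ≡ lastOr u xs
∈-endP⁻ u xs x∈ = [ inj₁ ∘ x∈⁅y⁆⇒x≡y u , inj₂ ∘ x∈⁅y⁆⇒x≡y _ ]′ (x∈p∪q⁻ _ _ x∈)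

head∈endP : ∀ {n} (u : Fin n) xs → u ∈ endP (u ∷ xs)
head∈endP u xs = x∈p∪q⁺ (inj₁ (x∈⁅x⁆ u))

last∈endP : ∀ {n} (u : Fin n) xs → lastOr u xs ∈ endP (u ∷ xs)
last∈endP u xs = x∈p∪q⁺ (inj₂ (x∈⁅x⁆ _))

endP⊆vset : ∀ {n} (P : List (Fin n)) → endP P ⊆ vset P
endP⊆vset []       x∈ = contradiction x∈ ∉⊥
endP⊆vset (u ∷ xs) x∈ with ∈-endP⁻ u xs x∈
... | inj₁ refl = ∈-vset⁺ (u ∷ xs) (here refl)
... | inj₂ refl = ∈-vset⁺ (u ∷ xs) (lastOr-∈ u xs)

module _ {n} (G : Graph n) (P : List (Fin n)) where

  ∈-adj-∪⁻ : ∀ {i j} → j ∈ adj (G ∪ᴳ pathGraph P) i → j ∈ adj G i ⊎ PathEdge P i j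
  ∈-adj-∪⁻ j∈ = [ inj₁ , inj₂ ∘ ∈-pathAdj⁻ P ]′ (x∈p∪q⁻ _ _ j∈)

  ∈-adj-∪⁺ : ∀ {i j} → j ∈ adj G i ⊎ PathEdge P i j → j ∈ adj (G ∪ᴳ pathGraph P) i
  ∈-adj-∪⁺ (inj₁ j∈G) = x∈p∪q⁺ (inj₁ j∈G)
  ∈-adj-∪⁺ (inj₂ e)   = x∈p∪q⁺ (inj₂ (∈-pathAdj⁺ P e))

  ∈-V-∪⁻ : ∀ {x} → x ∈ V (G ∪ᴳ pathGraph P) → x ∈ V G ⊎ x ∈ₗ P
  ∈-V-∪⁻ x∈ = [ inj₁ , inj₂ ∘ ∈-vset⁻ P ]′ (x∈p∪q⁻ _ _ x∈)

  ∈-V-∪⁺ : ∀ {x} → x ∈ V G ⊎ x ∈ₗ P → x ∈ V (G ∪ᴳ pathGraph P)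
  ∈-V-∪⁺ (inj₁ x∈G) = x∈p∪q⁺ (inj₁ x∈G)
  ∈-V-∪⁺ (inj₂ x∈P) = x∈p∪q⁺ (inj₂ (∈-vset⁺ P x∈P))

record _≈ᴳ_ {n} (G K : Graph n) : Set where
  field
    V⊆   : V G ⊆ V K
    V⊇   : V K ⊆ V G
    adj⊆ : ∀ i → adj G i ⊆ adj K i
    adj⊇ : ∀ i → adj K i ⊆ adj G i

  V-≡ : V G ≡ V K
  V-≡ = ⊆-antisym V⊆ V⊇

  edgeCount-≡ : edgeCount G ≡ edgeCount K
  edgeCount-≡ = edges-cong (λ i → ⊆-antisym (adj⊆ i) (adj⊇ i))

∪-absorbed : ∀ {n} (G : Graph n) P → (∀ {x} → x ∈ₗ P → x ∈ V G) →
             (∀ {i j} → PathEdge P i j → j ∈ adj G i) → G ≈ᴳ (G ∪ᴳ pathGraph P)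
∪-absorbed G P P⊆V P⊆E = record
  { V⊆   = ∈-V-∪⁺ G P ∘ inj₁
  ; V⊇   = [ id , P⊆V ]′ ∘ ∈-V-∪⁻ G P
  ; adj⊆ = λ i → ∈-adj-∪⁺ G P ∘ inj₁
  ; adj⊇ = λ i → [ id , P⊆E ]′ ∘ ∈-adj-∪⁻ G P
  }

∪-split : ∀ {n} (G : Graph n) xs x r →
          ((G ∪ᴳ pathGraph (xs ++ x ∷ [])) ∪ᴳ pathGraph (x ∷ r)) ≈ᴳ (G ∪ᴳ pathGraph (xs ++ x ∷ r))
∪-split {n} G xs x r = record
  { V⊆   = λ y∈ → ∈-V-∪⁺ G F (V-merge (∈-V-∪⁻ G′ (x ∷ r) y∈))
  ; V⊇   = λ y∈ → ∈-V-∪⁺ G′ (x ∷ r) (V-split (∈-V-∪⁻ G F y∈))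
  ; adj⊆ = λ i j∈ → ∈-adj-∪⁺ G F (adj-merge (∈-adj-∪⁻ G′ (x ∷ r) j∈))
  ; adj⊇ = λ i j∈ → ∈-adj-∪⁺ G′ (x ∷ r) (adj-split (∈-adj-∪⁻ G F j∈))
  }
  where
  Q F : List (Fin n)
  Q = xs ++ x ∷ []
  F = xs ++ x ∷ r
  G′ : Graph n
  G′ = G ∪ᴳ pathGraph Q
  V-merge : ∀ {y} → y ∈ V G′ ⊎ y ∈ₗ x ∷ r → y ∈ V G ⊎ y ∈ₗ F
  V-merge (inj₁ y∈G′) = [ inj₁ , inj₂ ∘ ∈-++-shared⁺ xs x r ∘ inj₁ ]′ (∈-V-∪⁻ G Q y∈G′)
  V-merge (inj₂ y∈R)  = inj₂ (∈-++-shared⁺ xs x r (inj₂ y∈R))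
  V-split : ∀ {y} → y ∈ V G ⊎ y ∈ₗ F → y ∈ V G′ ⊎ y ∈ₗ x ∷ r
  V-split (inj₁ y∈G) = inj₁ (∈-V-∪⁺ G Q (inj₁ y∈G))
  V-split (inj₂ y∈F) = [ inj₁ ∘ ∈-V-∪⁺ G Q ∘ inj₂ , inj₂ ]′ (∈-++-shared⁻ xs x r y∈F)
  adj-merge : ∀ {i j} → j ∈ adj G′ i ⊎ PathEdge (x ∷ r) i j → j ∈ adj G i ⊎ PathEdge F i j
  adj-merge (inj₁ j∈G′) = [ inj₁ , inj₂ ∘ PathEdge-++⁺ xs x r ∘ inj₁ ]′ (∈-adj-∪⁻ G Q j∈G′)
  adj-merge (inj₂ e)    = inj₂ (PathEdge-++⁺ xs x r (inj₂ e))
  adj-split : ∀ {i j} → j ∈ adj G i ⊎ PathEdge F i j → j ∈ adj G′ i ⊎ PathEdge (x ∷ r) i j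
  adj-split (inj₁ j∈G) = inj₁ (∈-adj-∪⁺ G Q (inj₁ j∈G))
  adj-split (inj₂ e)   = [ inj₁ ∘ ∈-adj-∪⁺ G Q ∘ inj₂ , inj₂ ]′ (PathEdge-++⁻ xs x r e)

∈-leaves⁻ : ∀ {n} (G : Graph n) {x} → x ∈ leaves G → ∣ adj G x ∣ ≡ 1
∈-leaves⁻ G {x} x∈ = ≡ᵇ⇒≡ _ 1 (subst T (sym (trans (sym (lookup∘tabulate _ x)) ([]=⇒lookup x∈))) tt)

leaves-of-path : ∀ {n} (S : Graph n) P → IsSAPath P →
                 (∀ i j → j ∈ adj (pathGraph P) i → j ∈ adj S i) → vset P ∩ leaves S ⊆ endP P
leaves-of-path S []       (_ , ())
leaves-of-path S (p ∷ ps) (uniq , _) P⊆S {x} x∈ with x∈p∩q⁻ (vset (p ∷ ps)) (leaves S) x∈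
... | x∈P , x∈L with x ≟ p
...   | yes refl = head∈endP p ps
...   | no x≢p with x ≟ lastOr p ps
...     | yes refl = last∈endP p ps
...     | no x≢last with interior-neighbours p ps uniq (∈-vset⁻ (p ∷ ps) x∈P) x≢p x≢last
...       | a , b , a≢b , xa , xb = contradiction (sym (∈-leaves⁻ S x∈L)) (<⇒≢ 2≤degree)
  where
  2≤degree : 2 ≤ ∣ adj S x ∣
  2≤degree = x≢y⇒2≤∣p∣ a≢b (P⊆S x a (∈-pathAdj⁺ (p ∷ ps) xa)) (P⊆S x b (∈-pathAdj⁺ (p ∷ ps) xb))

-- Pieces attached to a vertex set
-- Condition (1) of the theorem without the leaves, relative to a base vertex set B.
Attached : ∀ {n} → Subset n → List (List (Fin n)) → Set
Attached B []       = ⊤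
Attached B (P ∷ Ps) = vset P ∩ B ≡ endP P × Attached (B ∪ vset P) Ps

Attached-++ : ∀ {n} {B : Subset n} Ps {Qs} →
              Attached B Ps → Attached (B ∪ vsets Ps) Qs → Attached B (Ps ++ Qs)
Attached-++ {B = B} []       {Qs} _         att-Qs = subst (λ C → Attached C Qs) (∪-identityʳ B) att-Qs
Attached-++ {B = B} (P ∷ Ps) {Qs} (e , att) att-Qs =
  e , Attached-++ Ps att (subst (λ C → Attached C Qs) (sym (∪-assoc B (vset P) (vsets Ps))) att-Qs)

Attached⇒lookup : ∀ {n} {B : Subset n} Ps → Attached B Ps → ∀ r →
                  vset (lookup Ps r) ∩ (B ∪ vsets (take (toℕ r) Ps)) ≡ endP (lookup Ps r)
Attached⇒lookup {B = B} (P ∷ Ps) (e , _)   zero    = trans (cong (vset P ∩_) (∪-identityʳ B)) e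
Attached⇒lookup {B = B} (P ∷ Ps) (_ , att) (suc r) =
  trans (cong (vset (lookup Ps r) ∩_) (sym (∪-assoc B (vset P) (vsets (take (toℕ r) Ps)))))
        (Attached⇒lookup Ps att r)

Attached⇒lookup-∪ : ∀ {n} {B L : Subset n} Ps → Attached B Ps → All (λ P → vset P ∩ L ⊆ endP P) Ps →
                    ∀ r → vset (lookup Ps r) ∩ (B ∪ vsets (take (toℕ r) Ps) ∪ L) ≡ endP (lookup Ps r)
Attached⇒lookup-∪ {B = B} {L} Ps att L-ends r = begin
  P′ ∩ (B ∪ X ∪ L)           ≡⟨ cong (P′ ∩_) (sym (∪-assoc B X L)) ⟩
  P′ ∩ ((B ∪ X) ∪ L)         ≡⟨ ∩-distribˡ-∪ P′ (B ∪ X) L ⟩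
  P′ ∩ (B ∪ X) ∪ P′ ∩ L      ≡⟨ cong (_∪ P′ ∩ L) (Attached⇒lookup Ps att r) ⟩
  endP (lookup Ps r) ∪ P′ ∩ L ≡⟨ q⊆p⇒p∪q≡p (All.lookup L-ends (∈-lookup r)) ⟩
  endP (lookup Ps r)         ∎
  where
  open ≡-Reasoning
  P′ X : Subset _
  P′ = vset (lookup Ps r)
  X  = vsets (take (toℕ r) Ps)

-- The decomposition, built one path at a time
module Decompose {n} (H : Graph n) (M : ℕ) where

  record Decomposition (G : Graph n) (Ps : List (List (Fin n))) : Set where
    field
      paths    : All IsSAPath Ps
      covering : ∀ i j → j ∈ adj G i → j ∉ adj H i → Any (λ P → j ∈ adj (pathGraph P) i) Ps
      new      : All (λ P → ∀ i j → j ∈ adj (pathGraph P) i → j ∈ adj G i × j ∉ adj H i) Ps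
      disjoint : AllPairs (λ P Q → ∀ i j → j ∈ adj (pathGraph P) i → j ∉ adj (pathGraph Q) i) Ps
      attached : Attached (V H) Ps
      short    : All (λ P → edgeCount (pathGraph P) ≤ M) Ps
      -- t = τ(G) − τ(H) for t = length Ps, with both sides moved so that no subtraction occurs.
      excess   : edgeCount G + ∣ V H ∣ ≡ length Ps + edgeCount H + ∣ V G ∣
      V-pieces : V G ≡ V H ∪ vsets Ps
      adj-sym  : ∀ {i j} → j ∈ adj G i → i ∈ adj G j
      adj⊆V    : ∀ {i j} → j ∈ adj G i → i ∈ V G
      H⊆G      : ∀ {i j} → j ∈ adj H i → j ∈ adj G i

    V-H⊆V-G : V H ⊆ V G
    V-H⊆V-G x∈H = subst (_ ∈_) (sym V-pieces) (x∈p∪q⁺ (inj₁ x∈H))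

  Extension : Graph n → List (List (Fin n)) → Set
  Extension K Ps = Σ[ Qs ∈ List (List (Fin n)) ] Decomposition K (Ps ++ Qs)

  empty-decomposition : IsGraph H → Decomposition H []
  empty-decomposition (H-sym , _ , H-V) = record
    { paths    = []
    ; covering = λ i j j∈H j∉H → contradiction j∈H j∉H
    ; new      = []
    ; disjoint = []
    ; attached = tt
    ; short    = []
    ; excess   = refl
    ; V-pieces = sym (∪-identityʳ (V H))
    ; adj-sym  = H-sym _ _
    ; adj⊆V    = H-V _ _
    ; H⊆G      = id
    }

  Decomposition-resp-≈ : ∀ {G K Ps} → G ≈ᴳ K → Decomposition G Ps → Decomposition K Ps
  Decomposition-resp-≈ {Ps = Ps} G≈K D = record
    { paths    = paths
    ; covering = λ i j j∈K j∉H → covering i j (adj⊇ i j∈K) j∉H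
    ; new      = All.map (λ P-new i j j∈P → adj⊆ i (proj₁ (P-new i j j∈P)) , proj₂ (P-new i j j∈P)) new
    ; disjoint = disjoint
    ; attached = attached
    ; short    = short
    ; excess   = subst₂ (λ e v → e + ∣ V H ∣ ≡ length Ps + edgeCount H + ∣ v ∣) edgeCount-≡ V-≡ excess
    ; V-pieces = trans (sym V-≡) V-pieces
    ; adj-sym  = adj⊆ _ ∘ adj-sym ∘ adj⊇ _
    ; adj⊆V    = V⊆ ∘ adj⊆V ∘ adj⊇ _
    ; H⊆G      = adj⊆ _ ∘ H⊆G
    }
    where
    open Decomposition D
    open _≈ᴳ_ G≈K

  no-new-pieces : ∀ {G K Ps} → G ≈ᴳ K → Decomposition G Ps → Extension K Ps
  no-new-pieces {Ps = Ps} G≈K D = [] , subst (Decomposition _) (sym (++-identityʳ Ps)) (Decomposition-resp-≈ G≈K D)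

  module _ {G Ps} (D : Decomposition G Ps) {u y : Fin n} {acc : List (Fin n)}
           (u∈G : u ∈ V G) (y∈G : y ∈ V G) (acc∉G : All (_∉ V G) acc)
           (uniq : Unique (u ∷ acc ++ y ∷ []))
           (fresh : ∀ {i j} → PathEdge (u ∷ acc ++ y ∷ []) i j → j ∉ adj G i)
           (short-Q : length (acc ++ y ∷ []) ≤ M) where

    open Decomposition D

    private
      Q : List (Fin n)
      Q = u ∷ acc ++ y ∷ []

      G′ : Graph n
      G′ = G ∪ᴳ pathGraph Q

      ∈Q⁻ : ∀ {x} → x ∈ₗ Q → x ≡ u ⊎ x ∈ₗ acc ⊎ x ≡ y
      ∈Q⁻ (here x≡u) = inj₁ x≡u
      ∈Q⁻ (there x∈) with Any.++⁻ acc x∈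
      ... | inj₁ x∈acc      = inj₂ (inj₁ x∈acc)
      ... | inj₂ (here x≡y) = inj₂ (inj₂ x≡y)

      last-Q : lastOr u (acc ++ y ∷ []) ≡ y
      last-Q = lastOr-++ u acc y []

      Q∩G≡endP : vset Q ∩ V G ≡ endP Q
      Q∩G≡endP = ⊆-antisym ⊆endP endP⊆
        where
        ⊆endP : vset Q ∩ V G ⊆ endP Q
        ⊆endP x∈ with x∈p∩q⁻ (vset Q) (V G) x∈
        ... | x∈Q , x∈G with ∈Q⁻ (∈-vset⁻ Q x∈Q)
        ...   | inj₁ refl         = head∈endP u (acc ++ y ∷ [])
        ...   | inj₂ (inj₁ x∈acc) = contradiction x∈G (All.lookup acc∉G x∈acc)
        ...   | inj₂ (inj₂ refl)  = subst (_∈ endP Q) last-Q (last∈endP u (acc ++ y ∷ []))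
        endP⊆G : endP Q ⊆ V G
        endP⊆G x∈ with ∈-endP⁻ u (acc ++ y ∷ []) x∈
        ... | inj₁ refl    = u∈G
        ... | inj₂ x≡last = subst (_∈ V G) (sym (trans x≡last last-Q)) y∈G
        endP⊆ : endP Q ⊆ vset Q ∩ V G
        endP⊆ x∈ = x∈p∩q⁺ (endP⊆vset Q x∈ , endP⊆G x∈)

      edgeCount-G′ : edgeCount G′ ≡ edgeCount G + (length acc + 1)
      edgeCount-G′ = begin
        edgeCount G′                          ≡⟨ edges-∪ (adj G) (pathAdj Q) Q-new ⟩
        edgeCount G + edges (pathAdj Q)       ≡⟨ cong (edgeCount G +_) (edges-pathAdj Q uniq) ⟩
        edgeCount G + length (acc ++ y ∷ [])  ≡⟨ cong (edgeCount G +_) (length-++ acc) ⟩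
        edgeCount G + (length acc + 1)        ∎
        where
        open ≡-Reasoning
        Q-new : ∀ i {j} → j ∈ adj G i → j ∉ pathAdj Q i
        Q-new i j∈G j∈Q = fresh (∈-pathAdj⁻ Q j∈Q) j∈G

      ∣V-G′∣ : ∣ V G′ ∣ ≡ ∣ V G ∣ + length acc
      ∣V-G′∣ = trans (cong ∣_∣ (⊆-antisym ⊆acc acc⊆))
                     (∣p∪vset∣≡∣p∣+length (V G) acc acc∉G (AllPairs-++⁻ˡ acc (tail uniq)))
        where
        tail : ∀ {x xs} → Unique (x ∷ xs) → Unique xs
        tail (_ ∷ uq) = uq
        ⊆acc : V G ∪ vset Q ⊆ V G ∪ vset acc
        ⊆acc x∈ with x∈p∪q⁻ (V G) (vset Q) x∈
        ... | inj₁ x∈G = x∈p∪q⁺ (inj₁ x∈G)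
        ... | inj₂ x∈Q with ∈Q⁻ (∈-vset⁻ Q x∈Q)
        ...   | inj₁ refl         = x∈p∪q⁺ (inj₁ u∈G)
        ...   | inj₂ (inj₁ x∈acc) = x∈p∪q⁺ (inj₂ (∈-vset⁺ acc x∈acc))
        ...   | inj₂ (inj₂ refl)  = x∈p∪q⁺ (inj₁ y∈G)
        acc⊆Q : vset acc ⊆ vset Q
        acc⊆Q = ∈-vset⁺ Q ∘ there ∘ Any.++⁺ˡ ∘ ∈-vset⁻ acc
        acc⊆ : V G ∪ vset acc ⊆ V G ∪ vset Q
        acc⊆ x∈ = x∈p∪q⁺ ([ inj₁ , inj₂ ∘ acc⊆Q ]′ (x∈p∪q⁻ (V G) (vset acc) x∈))

      excess-G′ : edgeCount G′ + ∣ V H ∣ ≡ length (Ps ++ Q ∷ []) + edgeCount H + ∣ V G′ ∣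
      excess-G′ = begin
        edgeCount G′ + ∣ V H ∣                                ≡⟨ cong (_+ ∣ V H ∣) edgeCount-G′ ⟩
        edgeCount G + (length acc + 1) + ∣ V H ∣              ≡⟨ swap (edgeCount G) _ _ ⟩
        edgeCount G + ∣ V H ∣ + (length acc + 1)              ≡⟨ cong (_+ (length acc + 1)) excess ⟩
        length Ps + edgeCount H + ∣ V G ∣ + (length acc + 1)  ≡⟨ regroup (length Ps) _ _ _ ⟩
        length Ps + 1 + edgeCount H + (∣ V G ∣ + length acc)  ≡⟨ cong₂ (λ t v → t + edgeCount H + v)
                                                                        (sym (length-++ Ps)) (sym ∣V-G′∣) ⟩
        length (Ps ++ Q ∷ []) + edgeCount H + ∣ V G′ ∣        ∎
        where
        open ≡-Reasoning
        swap : ∀ e a v → e + a + v ≡ e + v + a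
        swap = solve-∀
        regroup : ∀ t e v a → t + e + v + (a + 1) ≡ t + 1 + e + (v + a)
        regroup = solve-∀

      V-pieces-G′ : V G′ ≡ V H ∪ vsets (Ps ++ Q ∷ [])
      V-pieces-G′ = begin
        V G ∪ vset Q                       ≡⟨ cong (_∪ vset Q) V-pieces ⟩
        (V H ∪ vsets Ps) ∪ vset Q          ≡⟨ ∪-assoc (V H) (vsets Ps) (vset Q) ⟩
        V H ∪ (vsets Ps ∪ vset Q)          ≡⟨ cong (λ s → V H ∪ (vsets Ps ∪ s))
                                                   (sym (∪-identityʳ (vset Q))) ⟩
        V H ∪ (vsets Ps ∪ vsets (Q ∷ []))  ≡⟨ cong (V H ∪_) (sym (vsets-++ Ps (Q ∷ []))) ⟩
        V H ∪ vsets (Ps ++ Q ∷ [])         ∎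
        where open ≡-Reasoning

      2≤length-Q : 2 ≤ length Q
      2≤length-Q = s≤s (subst (1 ≤_) (sym (length-++ acc)) (m≤n+m 1 (length acc)))

      old-new : ∀ {P} → (∀ i j → j ∈ adj (pathGraph P) i → j ∈ adj G i × j ∉ adj H i) →
                ∀ i j → j ∈ adj (pathGraph P) i → j ∈ adj G′ i × j ∉ adj H i
      old-new P-new i j j∈P = ∈-adj-∪⁺ G Q (inj₁ (proj₁ (P-new i j j∈P))) , proj₂ (P-new i j j∈P)

      Q-new : ∀ i j → j ∈ adj (pathGraph Q) i → j ∈ adj G′ i × j ∉ adj H i
      Q-new i j j∈Q = ∈-adj-∪⁺ G Q (inj₂ (∈-pathAdj⁻ Q j∈Q)) , fresh (∈-pathAdj⁻ Q j∈Q) ∘ H⊆G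

      old-disjoint-Q : ∀ {P} → (∀ i j → j ∈ adj (pathGraph P) i → j ∈ adj G i × j ∉ adj H i) →
                       ∀ i j → j ∈ adj (pathGraph P) i → j ∉ adj (pathGraph Q) i
      old-disjoint-Q P-new i j j∈P j∈Q = fresh (∈-pathAdj⁻ Q j∈Q) (proj₁ (P-new i j j∈P))

      covering-G′ : ∀ i j → j ∈ adj G′ i → j ∉ adj H i → Any (λ P → j ∈ adj (pathGraph P) i) (Ps ++ Q ∷ [])
      covering-G′ i j j∈G′ j∉H with ∈-adj-∪⁻ G Q j∈G′
      ... | inj₁ j∈G = Any.++⁺ˡ (covering i j j∈G j∉H)
      ... | inj₂ e   = Any.++⁺ʳ Ps (here (∈-pathAdj⁺ Q e))

    add-piece : Decomposition G′ (Ps ++ Q ∷ [])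
    add-piece = record
      { paths    = AllP.++⁺ paths ((uniq , 2≤length-Q) ∷ [])
      ; covering = covering-G′
      ; new      = AllP.++⁺ (All.map (λ {P} → old-new {P}) new) (Q-new ∷ [])
      ; disjoint = AllPairs.++⁺ disjoint ([] ∷ []) (All.map (λ {P} P-new → old-disjoint-Q {P} P-new ∷ []) new)
      ; attached = Attached-++ Ps attached (subst (λ B → vset Q ∩ B ≡ endP Q) V-pieces Q∩G≡endP , tt)
      ; short    = AllP.++⁺ short (subst (_≤ M) (sym (edges-pathAdj Q uniq)) short-Q ∷ [])
      ; excess   = excess-G′
      ; V-pieces = V-pieces-G′
      ; adj-sym  = ∈-adj-∪⁺ G Q ∘ [ inj₁ ∘ adj-sym , inj₂ ∘ PathEdge-sym Q ]′ ∘ ∈-adj-∪⁻ G Q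
      ; adj⊆V    = ∈-V-∪⁺ G Q ∘ [ inj₁ ∘ adj⊆V , inj₂ ∘ proj₁ ∘ PathEdge⇒∈ Q ]′
                     ∘ ∈-adj-∪⁻ G Q
      ; H⊆G      = ∈-adj-∪⁺ G Q ∘ inj₁ ∘ H⊆G
      }

  absorb-segment : ∀ {G Ps} → Decomposition G Ps → (u y : Fin n) (acc : List (Fin n)) →
                   u ∈ V G → y ∈ V G → All (_∉ V G) acc →
                   Unique (u ∷ acc ++ y ∷ []) → length (acc ++ y ∷ []) ≤ M →
                   Extension (G ∪ᴳ pathGraph (u ∷ acc ++ y ∷ [])) Ps
  absorb-segment {G} D u y [] u∈G y∈G _ uniq short-Q with y ∈? adj G u
  ... | yes y∈u = no-new-pieces (∪-absorbed G (u ∷ y ∷ []) uy⊆V uy⊆E) D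
    where
    uy⊆V : ∀ {x} → x ∈ₗ u ∷ y ∷ [] → x ∈ V G
    uy⊆V (here refl)         = u∈G
    uy⊆V (there (here refl)) = y∈G
    uy⊆E : ∀ {i j} → PathEdge (u ∷ y ∷ []) i j → j ∈ adj G i
    uy⊆E (here (inj₁ (refl , refl))) = y∈u
    uy⊆E (here (inj₂ (refl , refl))) = Decomposition.adj-sym D y∈u
  ... | no y∉u = _ , add-piece D u∈G y∈G [] uniq fresh short-Q
    where
    fresh : ∀ {i j} → PathEdge (u ∷ y ∷ []) i j → j ∉ adj G i
    fresh (here (inj₁ (refl , refl))) = y∉u
    fresh (here (inj₂ (refl , refl))) = y∉u ∘ Decomposition.adj-sym D
  absorb-segment {G} D u y (a ∷ as) u∈G y∈G acc∉G uniq short-Q =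
    _ , add-piece D u∈G y∈G acc∉G uniq fresh short-Q
    where
    open Decomposition D using (adj-sym; adj⊆V)
    fresh : ∀ {i j} → PathEdge (u ∷ a ∷ as ++ y ∷ []) i j → j ∉ adj G i
    fresh e j∈G with PathEdge-touches-interior u a as y e
    ... | inj₁ i∈acc = All.lookup acc∉G i∈acc (adj⊆V j∈G)
    ... | inj₂ j∈acc = All.lookup acc∉G j∈acc (adj⊆V (adj-sym j∈G))

  -- Walking along the path u ∷ acc ++ rest: u is the last vertex met in G and acc the vertices
  -- outside G met since; the current segment is closed at the next vertex of G.
  walk : ∀ {G Ps} → Decomposition G Ps → (u : Fin n) (acc rest : List (Fin n)) →
         u ∈ V G → All (_∉ V G) acc → Unique (u ∷ acc ++ rest) → lastOr u (acc ++ rest) ∈ V G →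
         length (acc ++ rest) ≤ M → Extension (G ∪ᴳ pathGraph (u ∷ acc ++ rest)) Ps
  walk {G} D u [] [] u∈G _ _ _ _ = no-new-pieces (∪-absorbed G (u ∷ []) (λ { (here refl) → u∈G }) (λ ())) D
  walk D u (a ∷ as) [] _ acc∉G _ last∈G _ = contradiction last∈G (All.lookup acc∉G last∈acc)
    where
    last∈acc : lastOr a (as ++ []) ∈ₗ a ∷ as
    last∈acc = subst (λ xs → lastOr a (as ++ []) ∈ₗ a ∷ xs) (++-identityʳ as) (lastOr-∈ a (as ++ []))
  walk {G} {Ps} D u acc (y ∷ r) u∈G acc∉G uniq last∈G short with y ∈? V G
  ... | no y∉G rewrite sym (++-assoc acc (y ∷ []) r) =
    walk D u (acc ++ y ∷ []) r u∈G (AllP.++⁺ acc∉G (y∉G ∷ [])) uniq last∈G short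
  ... | yes y∈G
    with absorb-segment D u y acc u∈G y∈G acc∉G (AllPairs-init (u ∷ acc) uniq) (≤-trans (length-init≤ acc) short)
  ...   | Qs₀ , D′
    with walk D′ y [] r (∈-V-∪⁺ G (u ∷ acc ++ y ∷ []) (inj₁ y∈G)) [] (AllPairs-++⁻ʳ (u ∷ acc) uniq)
              (∈-V-∪⁺ G (u ∷ acc ++ y ∷ []) (inj₁ (subst (_∈ V G) (lastOr-++ u acc y r) last∈G)))
              (≤-trans (length-tail≤ acc) short)
  ...     | Qs₁ , D″ =
    Qs₀ ++ Qs₁ ,
    Decomposition-resp-≈ (∪-split G (u ∷ acc) y r) (subst (Decomposition _) (++-assoc Ps Qs₀ Qs₁) D″)

  decompose : IsGraph H → (Ls : List (List (Fin n))) →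
              All (λ L → IsSAPath L × endP L ⊆ V H × edgeCount (pathGraph L) ≤ M) Ls →
              Σ[ Ps ∈ List (List (Fin n)) ] Decomposition (unionPaths H Ls) Ps
  decompose H-graph []       []               = [] , empty-decomposition H-graph
  decompose H-graph ([] ∷ _) (((_ , ()) , _) ∷ _)
  decompose H-graph ((u ∷ rest) ∷ Ls) (((uniq , _) , ends⊆H , short-L) ∷ hyps) with decompose H-graph Ls hyps
  ... | Ps , D with walk D u [] rest (end∈G (head∈endP u rest)) [] uniq (end∈G (last∈endP u rest))
                         (subst (_≤ M) (edges-pathAdj (u ∷ rest) uniq) short-L)
    where
    end∈G : ∀ {x} → x ∈ endP (u ∷ rest) → x ∈ V (unionPaths H Ls)
    end∈G = Decomposition.V-H⊆V-G D ∘ ends⊆H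
  ... | Qs , D′ = Ps ++ Qs , D′

-- Opened only here: the prefix +_ of ℤ makes ℕ sums such as ∣ p ∣ + ∣ q ∣ above ambiguous.
open import Data.Integer using (+_; _-_) renaming (_+_ to _+ℤ_)
open import Data.Integer.Properties using (pos-+)
import Data.Integer.Tactic.RingSolver as ℤ-Solver

excess-difference : ∀ eS vS eH vH t → eS + vH ≡ t + eH + vS → + t ≡ (+ eS - + vS) - (+ eH - + vH)
excess-difference eS vS eH vH t h = begin
  + t                                      ≡⟨ cancel (+ t) (+ eH) (+ vS) ⟩
  (+ t +ℤ + eH +ℤ + vS) - (+ eH +ℤ + vS)   ≡⟨ cong (_- (+ eH +ℤ + vS)) (sym h′) ⟩
  (+ eS +ℤ + vH) - (+ eH +ℤ + vS)          ≡⟨ regroup (+ eS) (+ vH) (+ eH) (+ vS) ⟩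
  (+ eS - + vS) - (+ eH - + vH)            ∎
  where
  open ≡-Reasoning
  h′ : + eS +ℤ + vH ≡ + t +ℤ + eH +ℤ + vS
  h′ = trans (sym (pos-+ eS vH)) (trans (cong +_ h) (trans (pos-+ (t + eH) vS) (cong (_+ℤ + vS) (pos-+ t eH))))
  cancel : ∀ a b c → a ≡ (a +ℤ b +ℤ c) - (b +ℤ c)
  cancel = ℤ-Solver.solve-∀
  regroup : ∀ a b c d → (a +ℤ b) - (c +ℤ d) ≡ (a - d) - (c - b)
  regroup = ℤ-Solver.solve-∀

lemmaA4 : ∀ {n : ℕ} (H : Graph n) → IsGraph H → (M : ℕ) → 1 ≤ M →
          (Ls : List (List (Fin n))) →
          All (λ L → IsSAPath L × endP L ⊆ V H × edgeCount (pathGraph L) ≤ M) Ls →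
          Σ[ Ps ∈ List (List (Fin n)) ]
            ( All IsSAPath Ps
            × (∀ i j → j ∈ adj (unionPaths H Ls) i → j ∉ adj H i →
                 Any (λ P → j ∈ adj (pathGraph P) i) Ps)
            × All (λ P → ∀ i j → j ∈ adj (pathGraph P) i →
                 j ∈ adj (unionPaths H Ls) i × j ∉ adj H i) Ps
            × AllPairs (λ P Q → ∀ i j → j ∈ adj (pathGraph P) i →
                 j ∉ adj (pathGraph Q) i) Ps
            × (∀ (r : Fin (length Ps)) →
                 vset (lookup Ps r) ∩ (V H ∪ vsets (take (toℕ r) Ps) ∪ leaves (unionPaths H Ls))
                   ≡ endP (lookup Ps r))
            × All (λ P → edgeCount (pathGraph P) ≤ M) Ps
            × (+ length Ps ≡ τ (unionPaths H Ls) - τ H) )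
lemmaA4 H H-graph M _ Ls hyps with Decompose.decompose H M H-graph Ls hyps
... | Ps , D =
  Ps , paths , covering , new , disjoint ,
  Attached⇒lookup-∪ Ps attached (All.zipWith leaves-are-ends (paths , new)) ,
  short ,
  excess-difference (edgeCount S) (∣ V S ∣) (edgeCount H) (∣ V H ∣) (length Ps) excess
  where
  open Decompose.Decomposition D
  S : Graph _
  S = unionPaths H Ls
  leaves-are-ends : ∀ {P} → IsSAPath P × (∀ i j → j ∈ adj (pathGraph P) i → j ∈ adj S i × j ∉ adj H i) →
                    vset P ∩ leaves S ⊆ endP P
  leaves-are-ends {P} (P-path , P-new) = leaves-of-path S P P-path (λ i j → proj₁ ∘ P-new i j)
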